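{- Let $M$ be a closed term with $R;\emptyset\vdash^{ef}M:A$ derivable in the effect-free system of the timed/synchronous language. Then exactly one of the following holds, where $E$ ranges over time insensitive evaluation contexts: (1) $M$ is a value; (2) $M=E[\Delta]$ where $\Delta$ has the shape $(\lambda x.N)V$, $\mathsf{set}(r,V)$, or $\mathsf{get}(r)$; (3) $M=E[E'[\Delta]\rhd N]$ for some evaluation context $E'$ and term $N$, where $\Delta$ has the shape $V$, $(\lambda x.N')V$, $\mathsf{set}(r,V)$, or $\mathsf{get}(r)$.
   Context: Syntax. Variables $x,\ldots$; regions $r,\ldots$. Terms $M ::= x\mid r\mid *\mid \lambda x.M\mid MM\mid \mathsf{get}(M)\mid\mathsf{set}(M,M)\mid M\rhd N$ ($M\rhd N$ is the else-next operator); values $V::= r\mid *\mid \lambda x.M$. Evaluation contexts $E ::= [\,]\mid EM\mid VE\mid \mathsf{get}(E)\mid\mathsf{set}(E,M)\mid\mathsf{set}(V,E)\mid E\rhd M$; elementary contexts $El ::= [\,]M\mid V[\,]\mid\mathsf{get}([\,])\mid\mathsf{set}([\,],M)\mid\mathsf{set}(V,[\,])\mid [\,]\rhd M$. Define $\mathrm{red}([\,])=[\,]$, $\mathrm{red}(E'\rhd N)=\mathrm{red}(E')$, and $\mathrm{red}(El[E'])=El[\mathrm{red}(E')]$ otherwise; $E$ is time insensitive if $\mathrm{red}(E)=E$. Effect-free type system. Types $A ::= \mathbf{1}\mid\mathrm{Reg}_rA\mid A\to A$; region contexts $R=r_1:A_1,\ldots,r_n:A_n$; contexts $\Gamma=x_1:A_1,\ldots$.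 Compatibility: $R\Vdash\mathbf 1$; $R\Vdash A$, $R\Vdash B$ give $R\Vdash A\to B$; $r:A\in R$ gives $R\Vdash\mathrm{Reg}_rA$; $R\vdash$ iff $R\Vdash R(r)$ for all $r$ in the domain of $R$; $R\vdash A$ iff $R\vdash$ and $R\Vdash A$; $R\vdash\Gamma$ iff $R\vdash$ and $R\vdash A_i$ for all $x_i:A_i\in\Gamma$. Rules: if $R\vdash\Gamma$ and $x:A\in\Gamma$ then $R;\Gamma\vdash^{ef}x:A$; if $R\vdash\Gamma$, $r:A\in R$ then $R;\Gamma\vdash^{ef}r:\mathrm{Reg}_rA$; if $R\vdash\Gamma$ then $R;\Gamma\vdash^{ef}*:\mathbf 1$; from $R;\Gamma,x:A\vdash^{ef}M:B$ infer $R;\Gamma\vdash^{ef}\lambda x.M:A\to B$; from $R;\Gamma\vdash^{ef}M:A\to B$ and $R;\Gamma\vdash^{ef}N:A$ infer $R;\Gamma\vdash^{ef}MN:B$; from $R;\Gamma\vdash^{ef}M:\mathrm{Reg}_rA$ infer $R;\Gamma\vdash^{ef}\mathsf{get}(M):A$; from $R;\Gamma\vdash^{ef}M:\mathrm{Reg}_rA$ and $R;\Gamma\vdash^{ef}N:A$ infer $R;\Gamma\vdash^{ef}\mathsf{set}(M,N):\mathbf 1$; from $R;\Gamma\vdash^{ef}M:A$ and $R;\Gamma\vdash^{ef}N:A$ infer $R;\Gamma\vdash^{ef}M\rhd N:A$. (This is the paper's type-and-effect system with all effects erased.) -}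

module Defs where

open import Data.Nat using (ℕ; zero; suc)
open import Data.List using (List; []; _∷_)
open import Data.List.Relation.Unary.All using (All)
open import Data.List.Membership.Propositional using (_∈_)
open import Data.Product using (_×_; _,_; Σ; ∃; ∃-syntax)
open import Data.Sum using (_⊎_)
open import Relation.Nullary using (¬_)
open import Relation.Binary.PropositionalEquality using (_≡_)

Region : Set
Region = ℕ

-- Syntax (variables as de Bruijn indices, regions as names ℕ)

data Term : Set where
  var  : ℕ → Term
  reg  : Region → Term
  unit : Term
  lam  : Term → Term          -- λx.M ; x is de Bruijn index 0 in M
  app  : Term → Term → Term
  get  : Term → Term
  set  : Term → Term → Term
  _▷_  : Term → Term → Term

data Val : Set where
  vreg  : Region → Val
  vunit : Val
  vlam  : Term → Val

⌜_⌝ : Val → Term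
⌜ vreg r ⌝ = reg r
⌜ vunit ⌝  = unit
⌜ vlam M ⌝ = lam M

IsValue : Term → Set
IsValue M = Σ Val (λ V → ⌜ V ⌝ ≡ M)

data ECtx : Set where
  hole   : ECtx
  appL   : ECtx → Term → ECtx
  appR   : Val → ECtx → ECtx
  getC   : ECtx → ECtx
  setL   : ECtx → Term → ECtx
  setR   : Val → ECtx → ECtx
  elseC  : ECtx → Term → ECtx

plug : ECtx → Term → Term
plug hole        t = t
plug (appL E M)  t = app (plug E t) M
plug (appR V E)  t = app ⌜ V ⌝ (plug E t)
plug (getC E)    t = get (plug E t)
plug (setL E M)  t = set (plug E t) M
plug (setR V E)  t = set ⌜ V ⌝ (plug E t)
plug (elseC E M) t = plug E t ▷ M

red : ECtx → ECtx
red hole        = hole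
red (appL E M)  = appL (red E) M
red (appR V E)  = appR V (red E)
red (getC E)    = getC (red E)
red (setL E M)  = setL (red E) M
red (setR V E)  = setR V (red E)
red (elseC E M) = red E

TimeInsensitive : ECtx → Set
TimeInsensitive E = red E ≡ E

data Ty : Set where
  𝟏    : Ty
  Reg  : Region → Ty → Ty
  _⇒_  : Ty → Ty → Ty

RegCtx : Set
RegCtx = List (Region × Ty)

Ctx : Set
Ctx = List Ty                    -- de Bruijn: index 0 is the last-bound variable

data _⊩_ (R : RegCtx) : Ty → Set where
  c𝟏   : R ⊩ 𝟏
  c⇒   : ∀ {A B} → R ⊩ A → R ⊩ B → R ⊩ (A ⇒ B)
  cReg : ∀ {r A} → (r , A) ∈ R → R ⊩ Reg r A

_⊢R : RegCtx → Set
R ⊢R = ∀ {r A} → (r , A) ∈ R → R ⊩ A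

_⊢ctx_ : RegCtx → Ctx → Set
R ⊢ctx Γ = (R ⊢R) × All (R ⊩_) Γ

data _∋_∶_ : Ctx → ℕ → Ty → Set where
  here  : ∀ {Γ A} → (A ∷ Γ) ∋ zero ∶ A
  there : ∀ {Γ A B n} → Γ ∋ n ∶ A → (B ∷ Γ) ∋ suc n ∶ A

data _︔_⊢ef_∶_ (R : RegCtx) : Ctx → Term → Ty → Set where
  tvar  : ∀ {Γ x A} → R ⊢ctx Γ → Γ ∋ x ∶ A → R ︔ Γ ⊢ef var x ∶ A
  treg  : ∀ {Γ r A} → R ⊢ctx Γ → (r , A) ∈ R → R ︔ Γ ⊢ef reg r ∶ Reg r A
  tunit : ∀ {Γ} → R ⊢ctx Γ → R ︔ Γ ⊢ef unit ∶ 𝟏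
  tlam  : ∀ {Γ M A B} → R ︔ (A ∷ Γ) ⊢ef M ∶ B → R ︔ Γ ⊢ef lam M ∶ (A ⇒ B)
  tapp  : ∀ {Γ M N A B} → R ︔ Γ ⊢ef M ∶ (A ⇒ B) → R ︔ Γ ⊢ef N ∶ A
        → R ︔ Γ ⊢ef app M N ∶ B
  tget  : ∀ {Γ M r A} → R ︔ Γ ⊢ef M ∶ Reg r A → R ︔ Γ ⊢ef get M ∶ A
  tset  : ∀ {Γ M N r A} → R ︔ Γ ⊢ef M ∶ Reg r A → R ︔ Γ ⊢ef N ∶ A
        → R ︔ Γ ⊢ef set M N ∶ 𝟏
  telse : ∀ {Γ M N A} → R ︔ Γ ⊢ef M ∶ A → R ︔ Γ ⊢ef N ∶ A
        → R ︔ Γ ⊢ef (M ▷ N) ∶ A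

data Redex : Term → Set where
  βredex   : ∀ N V → Redex (app (lam N) ⌜ V ⌝)
  setredex : ∀ r V → Redex (set (reg r) ⌜ V ⌝)
  getredex : ∀ r   → Redex (get (reg r))

data ElseRedex : Term → Set where
  val   : ∀ V → ElseRedex ⌜ V ⌝
  redex : ∀ {Δ} → Redex Δ → ElseRedex Δ

Case1 : Term → Set
Case1 M = IsValue M

Case2 : Term → Set
Case2 M = ∃[ E ] TimeInsensitive E × ∃[ Δ ] Redex Δ × M ≡ plug E Δ

Case3 : Term → Set
Case3 M = ∃[ E ] TimeInsensitive E × ∃[ E' ] ∃[ N ] ∃[ Δ ]
            ElseRedex Δ × M ≡ plug E (plug E' Δ ▷ N)

ExactlyOne3 : Set → Set → Set → Set
ExactlyOne3 P Q S = (P ⊎ Q ⊎ S) × ¬ (P × Q) × ¬ (P × S) × ¬ (Q × S)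

module Submission where

-- A closed term that is not a value is "active": it decomposes either as
-- E[Δ] with Δ a redex (case 2) or as E[E'[Δ] ▷ N] (case 3), with E time
-- insensitive.  Active terms stay active under time insensitive contexts,
-- because time insensitive contexts are closed under composition; for
-- M ▷ N we only need M = E'[Δ] for an arbitrary evaluation context E'.
--
-- Exclusivity uses two Boolean observations on terms.  `isValue?` shows
-- that plugging a non-value into any context gives a non-value, so case 1
-- excludes cases 2 and 3.  `spineElse` follows the evaluation spine (the
-- leftmost non-value subterm) and reports whether it ends in an else-next
-- M ▷ N.  Time insensitive contexts contain no else-next frame, so they do
-- not change `spineElse` of a non-value.  Therefore it is false in case 2
-- and true in case 3.

open import Defs
open import Data.Bool using (Bool; true; false; if_then_else_)
open import Data.List using ([])
open import Data.Product using (_×_; _,_; ∃-syntax)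
open import Data.Sum using (_⊎_; inj₁; inj₂)
open import Relation.Nullary using (¬_)
open import Relation.Binary.PropositionalEquality
  using (_≡_; refl; sym; trans; cong; cong₂; subst; module ≡-Reasoning)

isValue? : Term → Bool
isValue? (reg _) = true
isValue? unit    = true
isValue? (lam _) = true
isValue? _       = false

value-isValue? : ∀ V → isValue? ⌜ V ⌝ ≡ true
value-isValue? (vreg _) = refl
value-isValue? vunit    = refl
value-isValue? (vlam _) = refl

plug-nonvalue : ∀ E {t} → isValue? t ≡ false → isValue? (plug E t) ≡ false
plug-nonvalue hole        nv = nv
plug-nonvalue (appL _ _)  nv = refl
plug-nonvalue (appR _ _)  nv = refl
plug-nonvalue (getC _)    nv = refl
plug-nonvalue (setL _ _)  nv = refl
plug-nonvalue (setR _ _)  nv = refl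
plug-nonvalue (elseC _ _) nv = refl

redex-nonvalue : ∀ {Δ} → Redex Δ → isValue? Δ ≡ false
redex-nonvalue (βredex _ _)   = refl
redex-nonvalue (setredex _ _) = refl
redex-nonvalue (getredex _)   = refl

plug-not-value : ∀ E {t} → isValue? t ≡ false → ¬ IsValue (plug E t)
plug-not-value E {t} nv (V , eq) = true≢false
  (begin
    true                  ≡⟨ sym (value-isValue? V) ⟩
    isValue? ⌜ V ⌝        ≡⟨ cong isValue? eq ⟩
    isValue? (plug E t)   ≡⟨ plug-nonvalue E nv ⟩
    false                 ∎)
  where
  open ≡-Reasoning
  true≢false : ¬ (true ≡ false)
  true≢false ()

data ElseFree : ECtx → Set where
  hole : ElseFree hole
  appL : ∀ {E M} → ElseFree E → ElseFree (appL E M)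
  appR : ∀ {V E} → ElseFree E → ElseFree (appR V E)
  getC : ∀ {E}   → ElseFree E → ElseFree (getC E)
  setL : ∀ {E M} → ElseFree E → ElseFree (setL E M)
  setR : ∀ {V E} → ElseFree E → ElseFree (setR V E)

-- `red` erases every else-next frame, so time insensitive contexts are else-free.
red-elseFree : ∀ E → ElseFree (red E)
red-elseFree hole        = hole
red-elseFree (appL E _)  = appL (red-elseFree E)
red-elseFree (appR _ E)  = appR (red-elseFree E)
red-elseFree (getC E)    = getC (red-elseFree E)
red-elseFree (setL E _)  = setL (red-elseFree E)
red-elseFree (setR _ E)  = setR (red-elseFree E)
red-elseFree (elseC E _) = red-elseFree E

timeInsensitive-elseFree : ∀ {E} → TimeInsensitive E → ElseFree E
timeInsensitive-elseFree {E} ti = subst ElseFree ti (red-elseFree E)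

_∘E_ : ECtx → ECtx → ECtx
hole      ∘E F = F
appL E M  ∘E F = appL (E ∘E F) M
appR V E  ∘E F = appR V (E ∘E F)
getC E    ∘E F = getC (E ∘E F)
setL E M  ∘E F = setL (E ∘E F) M
setR V E  ∘E F = setR V (E ∘E F)
elseC E M ∘E F = elseC (E ∘E F) M

plug-∘ : ∀ E F t → plug (E ∘E F) t ≡ plug E (plug F t)
plug-∘ hole        F t = refl
plug-∘ (appL E M)  F t = cong (λ u → app u M) (plug-∘ E F t)
plug-∘ (appR V E)  F t = cong (app ⌜ V ⌝) (plug-∘ E F t)
plug-∘ (getC E)    F t = cong get (plug-∘ E F t)
plug-∘ (setL E M)  F t = cong (λ u → set u M) (plug-∘ E F t)
plug-∘ (setR V E)  F t = cong (set ⌜ V ⌝) (plug-∘ E F t)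
plug-∘ (elseC E M) F t = cong (_▷ M) (plug-∘ E F t)

red-∘ : ∀ E F → red (E ∘E F) ≡ red E ∘E red F
red-∘ hole        F = refl
red-∘ (appL E M)  F = cong (λ G → appL G M) (red-∘ E F)
red-∘ (appR V E)  F = cong (appR V) (red-∘ E F)
red-∘ (getC E)    F = cong getC (red-∘ E F)
red-∘ (setL E M)  F = cong (λ G → setL G M) (red-∘ E F)
red-∘ (setR V E)  F = cong (setR V) (red-∘ E F)
red-∘ (elseC E _) F = red-∘ E F

timeInsensitive-∘ : ∀ {E F} → TimeInsensitive E → TimeInsensitive F
                  → TimeInsensitive (E ∘E F)
timeInsensitive-∘ {E} {F} tE tF = trans (red-∘ E F) (cong₂ _∘E_ tE tF)

Active : Term → Set
Active M = Case2 M ⊎ Case3 M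

active-plug : ∀ F {M} → TimeInsensitive F → Active M → Active (plug F M)
active-plug F tF (inj₁ (E , tE , Δ , rd , refl)) =
  inj₁ (F ∘E E , timeInsensitive-∘ tF tE , Δ , rd , sym (plug-∘ F E Δ))
active-plug F tF (inj₂ (E , tE , E' , N , Δ , rd , refl)) =
  inj₂ (F ∘E E , timeInsensitive-∘ tF tE , E' , N , Δ , rd ,
        sym (plug-∘ F E (plug E' Δ ▷ N)))

decompose : ∀ {M} → Case1 M ⊎ Active M → ∃[ E ] ∃[ Δ ] ElseRedex Δ × M ≡ plug E Δ
decompose (inj₁ (V , refl)) = hole , ⌜ V ⌝ , val V , refl
decompose (inj₂ (inj₁ (E , _ , Δ , rd , eq))) = E , Δ , redex rd , eq
decompose (inj₂ (inj₂ (E , _ , E' , N , Δ , rd , eq))) =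
  E ∘E elseC E' N , Δ , rd , trans eq (sym (plug-∘ E (elseC E' N) Δ))

canonical-⇒ : ∀ {R Γ A B} V → R ︔ Γ ⊢ef ⌜ V ⌝ ∶ (A ⇒ B) → ∃[ N ] V ≡ vlam N
canonical-⇒ (vlam N) _ = N , refl

canonical-Reg : ∀ {R Γ r A} V → R ︔ Γ ⊢ef ⌜ V ⌝ ∶ Reg r A → ∃[ r' ] V ≡ vreg r'
canonical-Reg (vreg r) _ = r , refl

progress : ∀ {R M A} → R ︔ [] ⊢ef M ∶ A → Case1 M ⊎ Active M
progress (tvar _ ())
progress (treg _ _) = inj₁ (vreg _ , refl)
progress (tunit _)  = inj₁ (vunit , refl)
progress (tlam _)   = inj₁ (vlam _ , refl)
progress {M = app M N} (tapp dM dN) with progress dM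
... | inj₂ act = inj₂ (active-plug (appL hole N) refl act)
... | inj₁ (V , refl) with progress dN
...   | inj₂ act = inj₂ (active-plug (appR V hole) refl act)
...   | inj₁ (W , refl) with canonical-⇒ V dM
...     | body , refl = inj₂ (inj₁ (hole , refl , _ , βredex body W , refl))
progress (tget dM) with progress dM
... | inj₂ act = inj₂ (active-plug (getC hole) refl act)
... | inj₁ (V , refl) with canonical-Reg V dM
...   | r , refl = inj₂ (inj₁ (hole , refl , _ , getredex r , refl))
progress {M = set M N} (tset dM dN) with progress dM
... | inj₂ act = inj₂ (active-plug (setL hole N) refl act)
... | inj₁ (V , refl) with progress dN
...   | inj₂ act = inj₂ (active-plug (setR V hole) refl act)
...   | inj₁ (W , refl) with canonical-Reg V dM
...     | r , refl = inj₂ (inj₁ (hole , refl , _ , setredex r W , refl))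
progress {M = M ▷ N} (telse dM _) with decompose (progress dM)
... | E' , Δ , rd , refl = inj₂ (inj₂ (hole , refl , E' , N , Δ , rd , refl))

-- Whether the evaluation spine of a term ends in an else-next: in an
-- application or assignment it continues into the argument exactly when
-- the function (resp. region) part is already a value.
mutual
  spineElse : Term → Bool
  spineElse (app M N) = spineElse₂ M N
  spineElse (get M)   = spineElse M
  spineElse (set M N) = spineElse₂ M N
  spineElse (_ ▷ _)   = true
  spineElse _         = false

  spineElse₂ : Term → Term → Bool
  spineElse₂ M N = if isValue? M then spineElse N else spineElse M

spineElse₂-value : ∀ V N → spineElse₂ ⌜ V ⌝ N ≡ spineElse N
spineElse₂-value V N rewrite value-isValue? V = refl

spineElse₂-nonvalue : ∀ {M} N → isValue? M ≡ false → spineElse₂ M N ≡ spineElse M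
spineElse₂-nonvalue N nv rewrite nv = refl

spineElse-plug : ∀ {E t} → ElseFree E → isValue? t ≡ false
               → spineElse (plug E t) ≡ spineElse t
spineElse-plug hole nv = refl
spineElse-plug {appL E M} (appL fE) nv =
  trans (spineElse₂-nonvalue M (plug-nonvalue E nv)) (spineElse-plug fE nv)
spineElse-plug {appR V E} {t} (appR fE) nv =
  trans (spineElse₂-value V (plug E t)) (spineElse-plug fE nv)
spineElse-plug (getC fE) nv = spineElse-plug fE nv
spineElse-plug {setL E M} (setL fE) nv =
  trans (spineElse₂-nonvalue M (plug-nonvalue E nv)) (spineElse-plug fE nv)
spineElse-plug {setR V E} {t} (setR fE) nv =
  trans (spineElse₂-value V (plug E t)) (spineElse-plug fE nv)

spineElse-value : ∀ V → spineElse ⌜ V ⌝ ≡ false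
spineElse-value (vreg _) = refl
spineElse-value vunit    = refl
spineElse-value (vlam _) = refl

spineElse-redex : ∀ {Δ} → Redex Δ → spineElse Δ ≡ false
spineElse-redex (βredex _ V)   = spineElse-value V
spineElse-redex (setredex _ V) = spineElse-value V
spineElse-redex (getredex _)   = refl

case1-case2-disjoint : ∀ {M} → ¬ (Case1 M × Case2 M)
case1-case2-disjoint (value , E , _ , Δ , rd , refl) =
  plug-not-value E (redex-nonvalue rd) value

case1-case3-disjoint : ∀ {M} → ¬ (Case1 M × Case3 M)
case1-case3-disjoint (value , E , _ , _ , _ , _ , _ , refl) =
  plug-not-value E refl value

-- The spine of E[Δ] ends at the redex, that of E[E'[Δ] ▷ N] at the else-next.
case2-case3-disjoint : ∀ {M} → ¬ (Case2 M × Case3 M)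
case2-case3-disjoint ((E₁ , ti₁ , Δ , rd , refl) , (E₂ , ti₂ , E' , N , X , _ , eq)) =
  false≢true
    (begin
      false                               ≡⟨ sym (spineElse-redex rd) ⟩
      spineElse Δ                         ≡⟨ sym (spineElse-plug (timeInsensitive-elseFree ti₁)
                                                                 (redex-nonvalue rd)) ⟩
      spineElse (plug E₁ Δ)               ≡⟨ cong spineElse eq ⟩
      spineElse (plug E₂ (plug E' X ▷ N)) ≡⟨ spineElse-plug (timeInsensitive-elseFree ti₂) refl ⟩
      true                                ∎)
  where
  open ≡-Reasoning
  false≢true : ¬ (false ≡ true)
  false≢true ()

proposition8 : ∀ (R : RegCtx) (M : Term) (A : Ty)
    → R ︔ [] ⊢ef M ∶ A
    → ExactlyOne3 (Case1 M) (Case2 M) (Case3 M)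
proposition8 R M A d =
  progress d , case1-case2-disjoint , case1-case3-disjoint , case2-case3-disjoint
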